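{- $({\cal C},X)$ has a satisfying truth assignment if and only if $G$ has a colouring that respects~$L$.
   Context: Let $({\cal C},X)$ be an instance of Not-All-Equal 3-Satisfiability with positive literals only: $X=\{x_1,\ldots,x_n\}$ variables, ${\cal C}=\{C_1,\ldots,C_m\}$ clauses each with three positive literals; a truth assignment is satisfying if every clause has at least one true and at least one false literal. Construct $G$ with list assignment $L$: for each $x_i$ add adjacent vertices $x_i,\overline{x}_i$ with $L(x_i)=L(\overline{x}_i)=\{4,5\}$; for each $C_j$ add vertices $C_j,C_j'$ with $L(C_j)=L(C_j')=\{1,2,3\}$; add an edge between every vertex of type $x_i$ or $\overline{x}_i$ and every vertex of type $C_j$ or $C_j'$; for each clause $C_j=\{x_g,x_h,x_i\}$ (in a fixed order) add vertices $a_{g,j},a_{h,j},a_{i,j},a_{g,j}',a_{h,j}',a_{i,j}'$ with edges $x_ga_{g,j},a_{g,j}C_j,x_ha_{h,j},a_{h,j}C_j,x_ia_{i,j},a_{i,j}C_j$ and $\overline{x}_ga_{g,j}',a_{g,j}'C_j',\overline{x}_ha_{h,j}',a_{h,j}'C_j',\overline{x}_ia_{i,j}',a_{i,j}'C_j'$, and lists $L(a_{g,j})=L(a_{g,j}')=\{1,4\}$, $L(a_{h,j})=L(a_{h,j}')=\{2,4\}$, $L(a_{i,j})=L(a_{i,j}')=\{3,4\}$. A colouring respects $L$ if each vertex $u$ gets a colour from $L(u)$ and adjacent vertices get distinct colours. -}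

module Defs where

open import Data.Nat using (ℕ; suc)
open import Data.Fin using (Fin; toℕ)
open import Data.Bool using (Bool; true; false)
open import Data.List using (List; _∷_; [])
open import Data.List.Membership.Propositional using (_∈_)
open import Data.Product using (Σ; _×_; ∃-syntax)
open import Relation.Binary.PropositionalEquality using (_≡_; _≢_)
open import Function.Definitions using (Injective)

-- An instance of positive NAE-3SAT: n variables x_0..x_{n-1}, m clauses;
-- clause j is the ordered triple (cl j 0, cl j 1, cl j 2) of distinct variables
-- (the fixed order g, h, i of the paper).
record Instance : Set where
  field
    n  : ℕ
    m  : ℕ
    cl : Fin m → Fin 3 → Fin n
    distinct : ∀ j → Injective _≡_ _≡_ (cl j)
open Instance public

NAESatisfying : (I : Instance) → (Fin (n I) → Bool) → Set
NAESatisfying I τ =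
  ∀ j → (∃[ k ] τ (cl I j k) ≡ true) × (∃[ k ] τ (cl I j k) ≡ false)

NAESatisfiable : Instance → Set
NAESatisfiable I = ∃[ τ ] NAESatisfying I τ

-- Vertices of G.  a j k  is  a_{cl j k, j}  and  a' j k  is  a'_{cl j k, j}.
data Vertex (I : Instance) : Set where
  xv xbar : Fin (n I) → Vertex I
  cv cv'  : Fin (m I) → Vertex I
  a a'    : Fin (m I) → Fin 3 → Vertex I

-- Edges of G (each undirected edge listed once, in one orientation).
data Edge (I : Instance) : Vertex I → Vertex I → Set where
  x-xbar  : ∀ i → Edge I (xv i) (xbar i)
  x-C     : ∀ i j → Edge I (xv i) (cv j)
  x-C'    : ∀ i j → Edge I (xv i) (cv' j)
  xbar-C  : ∀ i j → Edge I (xbar i) (cv j)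
  xbar-C' : ∀ i j → Edge I (xbar i) (cv' j)
  x-a     : ∀ j k → Edge I (xv (cl I j k)) (a j k)
  a-C     : ∀ j k → Edge I (a j k) (cv j)
  xbar-a' : ∀ j k → Edge I (xbar (cl I j k)) (a' j k)
  a'-C'   : ∀ j k → Edge I (a' j k) (cv' j)

L : (I : Instance) → Vertex I → List ℕ
L I (xv _)   = 4 ∷ 5 ∷ []
L I (xbar _) = 4 ∷ 5 ∷ []
L I (cv _)   = 1 ∷ 2 ∷ 3 ∷ []
L I (cv' _)  = 1 ∷ 2 ∷ 3 ∷ []
L I (a _ k)  = suc (toℕ k) ∷ 4 ∷ []
L I (a' _ k) = suc (toℕ k) ∷ 4 ∷ []

RespectsL : (I : Instance) → (Vertex I → ℕ) → Set
RespectsL I c = (∀ u → c u ∈ L I u) × (∀ u v → Edge I u v → c u ≢ c v)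

HasLColouring : Instance → Set
HasLColouring I = ∃[ c ] RespectsL I c

module Submission where

-- Colours 4/5 on x_i record the truth value of x_i (4 = true), and x̄_i takes
-- the other one.  Colour k+1 on C_j (resp. C'_j) names a clause position k
-- whose variable is false (resp. true).  The gadget vertex a_{k,j} sits
-- between x and C_j with list {k+1, 4}; it may take k+1 only if x is true
-- (otherwise it clashes with x = 4), so C_j = k+1 forces x to be false.  The
-- primed gadget does the same for x̄ and C'_j, i.e. for the negated value.

open import Defs
open import Function.Base using (_∘_)
open import Function.Bundles using (_⇔_; mk⇔)
open import Data.Nat using (ℕ; suc)
open import Data.Fin using (Fin; toℕ; zero; suc)
open import Data.Bool using (Bool; true; false; not)
open import Data.Bool.Properties using (not-injective)
open import Data.List using (_∷_; [])
open import Data.List.Membership.Propositional using (_∈_)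
open import Data.List.Relation.Unary.Any using (here; there)
open import Data.Product using (_×_; _,_; proj₁; proj₂; ∃-syntax)
open import Relation.Nullary using (contradiction)
open import Relation.Binary.PropositionalEquality using (_≡_; _≢_; refl; sym; trans; cong)

pos : Fin 3 → ℕ
pos k = suc (toℕ k)

lit : Bool → ℕ
lit true  = 4
lit false = 5

gadget : Bool → Fin 3 → ℕ
gadget true  k = pos k
gadget false k = 4

pos-∈ : (k : Fin 3) → pos k ∈ 1 ∷ 2 ∷ 3 ∷ []
pos-∈ zero             = here refl
pos-∈ (suc zero)       = there (here refl)
pos-∈ (suc (suc zero)) = there (there (here refl))

lit-∈ : (b : Bool) → lit b ∈ 4 ∷ 5 ∷ []
lit-∈ true  = here refl
lit-∈ false = there (here refl)

gadget-∈ : (b : Bool) (k : Fin 3) → gadget b k ∈ pos k ∷ 4 ∷ []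
gadget-∈ true  k = here refl
gadget-∈ false k = there (here refl)

lit≢pos : (b : Bool) (k : Fin 3) → lit b ≢ pos k
lit≢pos true  zero             ()
lit≢pos true  (suc zero)       ()
lit≢pos true  (suc (suc zero)) ()
lit≢pos false zero             ()
lit≢pos false (suc zero)       ()
lit≢pos false (suc (suc zero)) ()

lit≢lit-not : (b : Bool) → lit b ≢ lit (not b)
lit≢lit-not true  ()
lit≢lit-not false ()

lit≢gadget : (b : Bool) (k : Fin 3) → lit b ≢ gadget b k
lit≢gadget true  k = lit≢pos true k
lit≢gadget false k ()

gadget≡pos : (b : Bool) (k k' : Fin 3) → gadget b k ≡ pos k' → b ≡ true × k ≡ k'
gadget≡pos true  k k' e = refl , pos-injective k k' e
  where
  pos-injective : (k k' : Fin 3) → pos k ≡ pos k' → k ≡ k'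
  pos-injective zero             zero             _ = refl
  pos-injective (suc zero)       (suc zero)       _ = refl
  pos-injective (suc (suc zero)) (suc (suc zero)) _ = refl
gadget≡pos false k k' e = contradiction e (lit≢pos true k')

gadget-avoids : (f : Fin 3 → Bool) (k k' : Fin 3) → f k' ≡ false → gadget (f k) k ≢ pos k'
gadget-avoids f k k' fk'≡false e with gadget≡pos (f k) k k' e
... | fk≡true , refl = contradiction (trans (sym fk≡true) fk'≡false) λ ()

pos-surjective : ∀ {x} → x ∈ 1 ∷ 2 ∷ 3 ∷ [] → ∃[ k ] x ≡ pos k
pos-surjective (here e)                 = zero , e
pos-surjective (there (here e))         = suc zero , e
pos-surjective (there (there (here e))) = suc (suc zero) , e

lit-pair : ∀ {x y} → x ∈ 4 ∷ 5 ∷ [] → y ∈ 4 ∷ 5 ∷ [] → x ≢ y →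
           ∃[ b ] x ≡ lit b × y ≡ lit (not b)
lit-pair (here refl)        (there (here refl)) _   = true , refl , refl
lit-pair (there (here refl)) (here refl)        _   = false , refl , refl
lit-pair (here refl)        (here refl)         x≢y = contradiction refl x≢y
lit-pair (there (here refl)) (there (here refl)) x≢y = contradiction refl x≢y

forced-false : ∀ {x b} (k : Fin 3) → x ∈ pos k ∷ 4 ∷ [] → lit b ≢ x → x ≢ pos k → b ≡ false
forced-false           k (here e)        _      x≢pos = contradiction e x≢pos
forced-false {b = true}  k (there (here e)) lit≢x _   = contradiction (sym e) lit≢x
forced-false {b = false} k (there (here e)) _     _   = refl

module ToColouring (I : Instance) (τ : Fin (n I) → Bool) (sat : NAESatisfying I τ) where

  trueAt falseAt : Fin (m I) → Fin 3
  trueAt  j = proj₁ (proj₁ (sat j))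
  falseAt j = proj₁ (proj₂ (sat j))

  colour : Vertex I → ℕ
  colour (xv i)   = lit (τ i)
  colour (xbar i) = lit (not (τ i))
  colour (cv j)   = pos (falseAt j)
  colour (cv' j)  = pos (trueAt j)
  colour (a j k)  = gadget (τ (cl I j k)) k
  colour (a' j k) = gadget (not (τ (cl I j k))) k

  respects : RespectsL I colour
  respects = fromL , proper
    where
    fromL : ∀ u → colour u ∈ L I u
    fromL (xv i)   = lit-∈ (τ i)
    fromL (xbar i) = lit-∈ (not (τ i))
    fromL (cv j)   = pos-∈ (falseAt j)
    fromL (cv' j)  = pos-∈ (trueAt j)
    fromL (a j k)  = gadget-∈ (τ (cl I j k)) k
    fromL (a' j k) = gadget-∈ (not (τ (cl I j k))) k

    -- The primed side is the unprimed side for the negated assignment.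
    proper : ∀ u v → Edge I u v → colour u ≢ colour v
    proper _ _ (x-xbar i)    = lit≢lit-not (τ i)
    proper _ _ (x-C i j)     = lit≢pos (τ i) (falseAt j)
    proper _ _ (x-C' i j)    = lit≢pos (τ i) (trueAt j)
    proper _ _ (xbar-C i j)  = lit≢pos (not (τ i)) (falseAt j)
    proper _ _ (xbar-C' i j) = lit≢pos (not (τ i)) (trueAt j)
    proper _ _ (x-a j k)     = lit≢gadget (τ (cl I j k)) k
    proper _ _ (a-C j k)     =
      gadget-avoids (τ ∘ cl I j) k (falseAt j) (proj₂ (proj₂ (sat j)))
    proper _ _ (xbar-a' j k) = lit≢gadget (not (τ (cl I j k))) k
    proper _ _ (a'-C' j k)   =
      gadget-avoids (not ∘ τ ∘ cl I j) k (trueAt j) (cong not (proj₂ (proj₁ (sat j))))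

module FromColouring (I : Instance) (c : Vertex I → ℕ) (respects : RespectsL I c) where

  private
    inL    = proj₁ respects
    proper = proj₂ respects

  literal : ∀ i → ∃[ b ] c (xv i) ≡ lit b × c (xbar i) ≡ lit (not b)
  literal i = lit-pair (inL (xv i)) (inL (xbar i)) (proper _ _ (x-xbar i))

  τ : Fin (n I) → Bool
  τ i = proj₁ (literal i)

  xv-colour : ∀ i → c (xv i) ≡ lit (τ i)
  xv-colour i = proj₁ (proj₂ (literal i))

  xbar-colour : ∀ i → c (xbar i) ≡ lit (not (τ i))
  xbar-colour i = proj₂ (proj₂ (literal i))

  false-witness : ∀ j → ∃[ k ] τ (cl I j k) ≡ false
  false-witness j with pos-surjective (inL (cv j))
  ... | k , ck = k , forced-false k (inL (a j k))
                       (λ e → proper _ _ (x-a j k) (trans (xv-colour _) e))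
                       (λ e → proper _ _ (a-C j k) (trans e (sym ck)))

  true-witness : ∀ j → ∃[ k ] τ (cl I j k) ≡ true
  true-witness j with pos-surjective (inL (cv' j))
  ... | k , ck = k , not-injective (forced-false k (inL (a' j k))
                       (λ e → proper _ _ (xbar-a' j k) (trans (xbar-colour _) e))
                       (λ e → proper _ _ (a'-C' j k) (trans e (sym ck))))

  satisfying : NAESatisfying I τ
  satisfying j = true-witness j , false-witness j

lemma7 : (I : Instance) → NAESatisfiable I ⇔ HasLColouring I
lemma7 I = mk⇔ colouring assignment
  where
  colouring : NAESatisfiable I → HasLColouring I
  colouring (τ , sat) = ToColouring.colour I τ sat , ToColouring.respects I τ sat

  assignment : HasLColouring I → NAESatisfiable I
  assignment (c , ok) = FromColouring.τ I c ok , FromColouring.satisfying I c ok
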